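{- Let $p$ be the partially ordered pattern of length $5$ on the labels $\{1,2,3,4,5\}$ whose only relations are $1>2$, $1>3$, $4>2$, $4>3$ (label $5$ is incomparable to all others). Let $a(n)$ be the number of $n$-permutations avoiding $p$. Then $$\sum_{n\geq 0}a(n)x^n=\frac{1-7x+14x^2-6x^3+4x^4}{(1-4x+2x^2)^2}.$$
   Context: An $n$-permutation is a permutation $\pi=\pi_1\cdots\pi_n$ of $\{1,\dots,n\}$ written in one-line notation (for $n=0$ there is exactly one, the empty permutation). A partially ordered pattern (POP) $p$ of length $k$ is a partial order $<_P$ on the label set $\{1,\dots,k\}$. An occurrence of $p$ in $\pi$ is a subsequence $\pi_{i_1}\pi_{i_2}\cdots\pi_{i_k}$ with $1\leq i_1<\cdots<i_k\leq n$ such that $\pi_{i_j}<\pi_{i_m}$ whenever $j<_P m$ (no condition is imposed on pairs of incomparable labels). A permutation avoids $p$ if it contains no occurrence of $p$. -}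

module Defs where

open import Data.Nat using (ℕ; zero; suc)
open import Data.Fin using (Fin; zero; suc; _<_)
open import Data.Vec using (Vec; lookup)
open import Data.List using (List; length)
open import Data.List.Membership.Propositional using (_∈_)
open import Data.List.Relation.Unary.Unique.Propositional using (Unique)
open import Data.Integer using (ℤ; +_; -[1+_]) renaming (_+_ to _+ℤ_; _*_ to _*ℤ_)
open import Data.Product using (Σ; _×_; ∃)
open import Relation.Binary.PropositionalEquality using (_≡_)
open import Relation.Nullary using (¬_)
open import Function.Bundles using (_⇔_)

-- An n-permutation in one-line notation: π = π₁⋯πₙ stored as a vector of
-- values in Fin n (value v stands for v+1), required to be injective
-- (hence bijective on the finite set Fin n).
IsPerm : (n : ℕ) → Vec (Fin n) n → Set
IsPerm n π = ∀ (i j : Fin n) → lookup π i ≡ lookup π j → i ≡ j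

-- A partially ordered pattern of length k is given by its strict order
-- relation  j <P m  on labels Fin k (label j+1 is represented by j).
POP : ℕ → Set₁
POP k = Fin k → Fin k → Set

Occurrence : ∀ {k n} → POP k → Vec (Fin n) n → Set
Occurrence {k} {n} p π =
  Σ (Fin k → Fin n) λ i →
    (∀ (j m : Fin k) → j < m → i j < i m) ×
    (∀ (j m : Fin k) → p j m → lookup π (i j) < lookup π (i m))

Avoids : ∀ {k n} → POP k → Vec (Fin n) n → Set
Avoids p π = ¬ Occurrence p π

-- The POP of the theorem: labels 1..5 are zero..4;
-- relations 1 > 2, 1 > 3, 4 > 2, 4 > 3 (i.e. 2 <P 1, 3 <P 1, 2 <P 4, 3 <P 4).
data P35 : Fin 5 → Fin 5 → Set where
  2<1 : P35 (suc zero) zero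
  3<1 : P35 (suc (suc zero)) zero
  2<4 : P35 (suc zero) (suc (suc (suc zero)))
  3<4 : P35 (suc (suc zero)) (suc (suc (suc zero)))

NumAvoiders : ∀ {k} → POP k → ℕ → ℕ → Set
NumAvoiders p n m =
  Σ (List (Vec (Fin n) n)) λ L →
    Unique L ×
    (∀ (π : Vec (Fin n) n) → (π ∈ L) ⇔ (IsPerm n π × Avoids p π)) ×
    length L ≡ m

Series : Set
Series = ℕ → ℤ

cauchy : (ℕ → ℤ) → (ℕ → ℤ) → ℕ → ℤ
cauchy f g zero = f zero *ℤ g zero
cauchy f g (suc n) = f zero *ℤ g (suc n) +ℤ cauchy (λ i → f (suc i)) g n

_⊛_ : Series → Series → Series
(f ⊛ g) n = cauchy f g n

-- polynomial from its coefficient list (constant term first)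
poly : List ℤ → Series
poly Data.List.[] n = + 0
poly (c Data.List.∷ cs) zero = c
poly (c Data.List.∷ cs) (suc n) = poly cs n

toSeries : (ℕ → ℕ) → Series
toSeries a n = + (a n)

den35 : Series
den35 = poly (+ 1 Data.List.∷ -[1+ 3 ] Data.List.∷ + 2 Data.List.∷ Data.List.[])

num35 : Series
num35 = poly (+ 1 Data.List.∷ -[1+ 6 ] Data.List.∷ + 14 Data.List.∷ -[1+ 5 ] Data.List.∷ + 4 Data.List.∷ Data.List.[])

-- An occurrence of P35 in π₁⋯πₙ₊₁ is a dip (positions i < j < k < l with πⱼ and πₖ below both
-- πᵢ and πₗ) followed by any later entry. So π avoids P35 iff π₁⋯πₙ contains no dip, and as
-- πₙ₊₁ is arbitrary, a(n+1) = (n+1)·b(n) where b(m) counts the dip-free m-permutations.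
--
-- Dip-free permutations grow by inserting a new maximum. Inserting it at site h creates a dip
-- exactly when two smaller entries at sites ≥ h are followed by a larger one, or two entries
-- before h are preceded by a larger one; the remaining (active) sites form an interval [r, l].
-- Inserting at r + k gives the child interval [r + max(k − 1, 0), min(r + k + 2, l + 1)], whose
-- width depends only on k and l − r and never exceeds 3. Counting the nodes of this generating
-- tree by width gives b(m + 2) = 4·b(m + 1) − 2·b(m), so (1 − 4x + 2x²)² annihilates a beyond
-- degree 4.

module Submission where

open import Defs
open import Data.Nat using (ℕ; zero; suc)
open import Data.Product using (Σ; _×_; _,_)
open import Relation.Binary.PropositionalEquality using (_≡_)

module Enumeration where
  open import Data.Nat
    using (ℕ; zero; suc; _+_; _*_; _∸_; _≤_; _<_; _⊔_; _⊓_; pred; z≤n; s≤s; s≤s⁻¹; _≤?_)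
  open import Data.Nat.Properties
    using (≤-refl; ≤-trans; ≤-reflexive; <-trans; <-≤-trans; ≤-<-trans; <-irrefl;
           <⇒≤; <⇒≱; <⇒≢; >⇒≢;
           ≰⇒>; ≮⇒≥; n≤1+n; n<1+n; m≤n+m; +-assoc; +-monoˡ-≤; +-cancelʳ-≡; +-distribʳ-⊓;
           ⊔-sel; ⊓-sel; ⊔-lub; ⊓-glb; m⊓n≤m; m⊓n≤n;
           m<n⇒m<n⊔o; m<n⇒m<o⊔n; m≤n⇒m⊔n≡n; m≥n⇒m⊔n≡m;
           pred[n]≤n; suc[m]≤n⇒m≤pred[n]; pred-cancel-<; m∸n+n≡m; m+n∸n≡m; ∸-monoˡ-≤)
  open import Data.Nat.Tactic.RingSolver using (solve-∀)
  open import Data.Fin using (Fin; zero; suc; toℕ; fromℕ; fromℕ<; inject₁; punchIn; punchOut; _≟_)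
  open import Data.Fin.Properties
    using (toℕ<n; toℕ-fromℕ; toℕ-fromℕ<; toℕ-injective; ¬Fin0; any?; pigeonhole; ≤∧≢⇒<;
           punchIn-injective; punchIn-mono-≤; punchIn-cancel-≤; punchInᵢ≢i; punchIn-punchOut; punchOut-injective)
  open import Data.Vec as Vec using (Vec; []; lookup; insertAt; tabulate)
  open import Data.Vec.Properties
    using (insertAt-lookup; insertAt-punchIn; lookup-map; lookup∘tabulate; tabulate∘lookup; tabulate-cong)
  open import Data.List using (List; []; _∷_; _++_; map; concatMap; length; allFin; cartesianProductWith)
  open import Data.List.Properties using (length-++; length-map; length-tabulate; map-∘; map-concatMap)
  open import Data.List.Membership.Propositional using (_∈_)
  open import Data.List.Membership.Propositional.Properties
    using (∈-map⁻; ∈-map⁺; ∈-allFin; ∈-concat⁺′; ∈-cartesianProductWith⁺; ∈-cartesianProductWith⁻)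
  open import Data.List.Relation.Unary.Any using (here)
  open import Data.List.Relation.Unary.All as All using (All; []; _∷_)
  import Data.List.Relation.Unary.All.Properties as All
  open import Data.List.Relation.Unary.AllPairs as AllPairs using ([]; _∷_)
  import Data.List.Relation.Unary.AllPairs.Properties as AllPairs
  open import Data.List.Relation.Unary.Unique.Propositional using (Unique)
  import Data.List.Relation.Unary.Unique.Propositional.Properties as Unique
  open import Data.List.Relation.Binary.Disjoint.Propositional using (Disjoint)
  open import Data.Product using (Σ; ∃; ∃₂; _×_; _,_; proj₂)
  open import Data.Sum using (_⊎_; inj₁; inj₂; [_,_]′)
  open import Data.Empty using (⊥-elim)
  open import Function using (_∘_)
  open import Function.Bundles using (mk⇔)
  open import Relation.Binary.PropositionalEquality
    using (_≢_; refl; sym; trans; cong; cong₂; subst; subst₂; module ≡-Reasoning)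
  open import Relation.Nullary using (¬_; yes; no)

  punchIn-mono-< : ∀ {m} (g : Fin (suc m)) (a b : Fin m) →
                   toℕ a < toℕ b → toℕ (punchIn g a) < toℕ (punchIn g b)
  punchIn-mono-< g a b a<b =
    ≤∧≢⇒< (punchIn-mono-≤ g a b (<⇒≤ a<b)) (<⇒≢ a<b ∘ cong toℕ ∘ punchIn-injective g a b)

  punchIn-cancel-< : ∀ {m} (g : Fin (suc m)) (a b : Fin m) →
                     toℕ (punchIn g a) < toℕ (punchIn g b) → toℕ a < toℕ b
  punchIn-cancel-< g a b p =
    ≤∧≢⇒< (punchIn-cancel-≤ g a b (<⇒≤ p)) (<⇒≢ p ∘ cong (toℕ ∘ punchIn g))

  ≤⇒<punchIn : ∀ {m} (g : Fin (suc m)) (j : Fin m) → toℕ g ≤ toℕ j → toℕ g < toℕ (punchIn g j)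
  ≤⇒<punchIn zero    j       _         = s≤s z≤n
  ≤⇒<punchIn (suc g) (suc j) (s≤s g≤j) = s≤s (≤⇒<punchIn g j g≤j)

  <⇒punchIn< : ∀ {m} (g : Fin (suc m)) (j : Fin m) → toℕ j < toℕ g → toℕ (punchIn g j) < toℕ g
  <⇒punchIn< (suc g) zero    _         = s≤s z≤n
  <⇒punchIn< (suc g) (suc j) (s≤s j<g) = s≤s (<⇒punchIn< g j j<g)

  punchIn-≥ : ∀ {m} (g : Fin (suc m)) (j : Fin m) → toℕ j ≤ toℕ (punchIn g j)
  punchIn-≥ zero    j       = n≤1+n _
  punchIn-≥ (suc g) zero    = z≤n
  punchIn-≥ (suc g) (suc j) = s≤s (punchIn-≥ g j)

  punchIn-≤ : ∀ {m} (g : Fin (suc m)) (j : Fin m) → toℕ (punchIn g j) ≤ suc (toℕ j)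
  punchIn-≤ zero    j       = ≤-refl
  punchIn-≤ (suc g) zero    = z≤n
  punchIn-≤ (suc g) (suc j) = s≤s (punchIn-≤ g j)

  <punchIn⇒≤ : ∀ {m} (g : Fin (suc m)) (j : Fin m) → toℕ g < toℕ (punchIn g j) → toℕ g ≤ toℕ j
  <punchIn⇒≤ zero    j       _         = z≤n
  <punchIn⇒≤ (suc g) (suc j) (s≤s g<j) = s≤s (<punchIn⇒≤ g j g<j)

  punchIn<⇒< : ∀ {m} (g : Fin (suc m)) (j : Fin m) → toℕ (punchIn g j) < toℕ g → toℕ j < toℕ g
  punchIn<⇒< (suc g) zero    _         = s≤s z≤n
  punchIn<⇒< (suc g) (suc j) (s≤s j<g) = s≤s (punchIn<⇒< g j j<g)

  data PunchInView {m} (g : Fin (suc m)) : Fin (suc m) → Set where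
    at       : PunchInView g g
    punched  : (j : Fin m) → PunchInView g (punchIn g j)

  punchInView : ∀ {m} (g p : Fin (suc m)) → PunchInView g p
  punchInView g p with g ≟ p
  ... | yes refl = at
  ... | no g≢p   = subst (PunchInView g) (punchIn-punchOut g≢p) (punched (punchOut g≢p))

  ≤-punchIn⇒≤ : ∀ {m h} (g : Fin (suc m)) (j : Fin m) →
                h ≤ toℕ g → h ≤ toℕ (punchIn g j) → h ≤ toℕ j
  ≤-punchIn⇒≤ {h = zero}  g       j       _         _         = z≤n
  ≤-punchIn⇒≤ {h = suc h} (suc g) (suc j) (s≤s h≤g) (s≤s h≤j) = s≤s (≤-punchIn⇒≤ g j h≤g h≤j)

  punchIn<1+⇒< : ∀ {m h} (g : Fin (suc m)) (j : Fin m) → toℕ g ≤ h → toℕ (punchIn g j) < suc h → toℕ j < h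
  punchIn<1+⇒< zero    j       _         (s≤s j<h) = j<h
  punchIn<1+⇒< (suc g) zero    (s≤s _)   _         = s≤s z≤n
  punchIn<1+⇒< (suc g) (suc j) (s≤s g≤h) (s≤s j<h) = s≤s (punchIn<1+⇒< g j g≤h j<h)

  ≢⇒∃punchIn : ∀ {m} (g p : Fin (suc m)) → toℕ p ≢ toℕ g → ∃ λ j → punchIn g j ≡ p
  ≢⇒∃punchIn g p p≢g with punchInView g p
  ... | at        = ⊥-elim (p≢g refl)
  ... | punched j = j , refl

  toℕ-punchIn-fromℕ : ∀ {m} (x : Fin m) → toℕ (punchIn (fromℕ m) x) ≡ toℕ x
  toℕ-punchIn-fromℕ zero    = refl
  toℕ-punchIn-fromℕ (suc x) = cong suc (toℕ-punchIn-fromℕ x)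

  -- Permutations as vectors: inserting a value at a position

  lookup-ext : ∀ {A : Set} {n} {xs ys : Vec A n} → (∀ i → lookup xs i ≡ lookup ys i) → xs ≡ ys
  lookup-ext {xs = xs} {ys} eq = trans (sym (tabulate∘lookup xs)) (trans (tabulate-cong eq) (tabulate∘lookup ys))

  insert : ∀ {n} → Fin (suc n) → Fin (suc n) → Vec (Fin n) n → Vec (Fin (suc n)) (suc n)
  insert g v σ = insertAt (Vec.map (punchIn v) σ) g v

  module _ {n} (g v : Fin (suc n)) (σ : Vec (Fin n) n) where

    lookup-insert : lookup (insert g v σ) g ≡ v
    lookup-insert = insertAt-lookup (Vec.map (punchIn v) σ) g v

    lookup-insert-punchIn : ∀ j → lookup (insert g v σ) (punchIn g j) ≡ punchIn v (lookup σ j)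
    lookup-insert-punchIn j = trans (insertAt-punchIn (Vec.map (punchIn v) σ) g v j) (lookup-map j (punchIn v) σ)

    insert-perm : IsPerm n σ → IsPerm (suc n) (insert g v σ)
    insert-perm σ-perm p q eq with punchInView g p | punchInView g q
    ... | at        | at        = refl
    ... | at        | punched j =
      ⊥-elim (punchInᵢ≢i v _ (sym (trans (sym lookup-insert) (trans eq (lookup-insert-punchIn j)))))
    ... | punched i | at        =
      ⊥-elim (punchInᵢ≢i v _ (trans (sym (lookup-insert-punchIn i)) (trans eq lookup-insert)))
    ... | punched i | punched j = cong (punchIn g) (σ-perm i j (punchIn-injective v _ _
            (trans (sym (lookup-insert-punchIn i)) (trans eq (lookup-insert-punchIn j)))))

  insert-injectiveˡ : ∀ {n} {g g′ v : Fin (suc n)} {σ σ′ : Vec (Fin n) n} →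
                      insert g v σ ≡ insert g′ v σ′ → g ≡ g′
  insert-injectiveˡ {g = g} {g′} {v} {σ} {σ′} eq with punchInView g′ g
  ... | at        = refl
  ... | punched j = ⊥-elim (punchInᵢ≢i v _ (sym (trans (sym (lookup-insert g v σ))
                      (trans (cong (λ π → lookup π g) eq) (lookup-insert-punchIn g′ v σ′ j)))))

  insert-injective : ∀ {n} {g v v′ : Fin (suc n)} {σ σ′ : Vec (Fin n) n} →
                     insert g v σ ≡ insert g v′ σ′ → v ≡ v′ × σ ≡ σ′
  insert-injective {g = g} {v} {v′} {σ} {σ′} eq
    with trans (sym (lookup-insert g v σ)) (trans (cong (λ π → lookup π g) eq) (lookup-insert g v′ σ′))
  ... | refl = refl , lookup-ext λ j → punchIn-injective v _ _ (trans (sym (lookup-insert-punchIn g v σ j))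
                 (trans (cong (λ π → lookup π (punchIn g j)) eq) (lookup-insert-punchIn g v σ′ j)))

  insert-injectiveʳ : ∀ {n} {g g′ v : Fin (suc n)} {σ σ′ : Vec (Fin n) n} →
                      insert g v σ ≡ insert g′ v σ′ → σ ≡ σ′
  insert-injectiveʳ eq with insert-injectiveˡ eq
  ... | refl = proj₂ (insert-injective eq)

  perm-surjective : ∀ {n} (π : Vec (Fin n) n) → IsPerm n π → ∀ v → ∃ λ g → lookup π g ≡ v
  perm-surjective {suc m} π π-perm v with any? (λ g → lookup π g ≟ v)
  ... | yes hit  = hit
  ... | no  miss = ⊥-elim (collision (pigeonhole (n<1+n m) (λ p → punchOut (v≢ p))))
    where
    v≢ : ∀ p → v ≢ lookup π p
    v≢ p e = miss (p , sym e)
    collision : ¬ ∃₂ λ i j → toℕ i < toℕ j × punchOut (v≢ i) ≡ punchOut (v≢ j)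
    collision (i , j , i<j , eq) = <⇒≢ i<j (cong toℕ (π-perm i j (punchOut-injective (v≢ i) (v≢ j) eq)))

  insert-surjective-at : ∀ {n} (π : Vec (Fin (suc n)) (suc n)) → IsPerm (suc n) π → ∀ g →
                         Σ (Vec (Fin n) n) λ σ → IsPerm n σ × insert g (lookup π g) σ ≡ π
  insert-surjective-at {n} π π-perm g = σ , σ-perm , lookup-ext entries
    where
    v : Fin (suc n)
    v = lookup π g
    v≢ : ∀ j → v ≢ lookup π (punchIn g j)
    v≢ j eq = punchInᵢ≢i g j (sym (π-perm _ _ eq))
    σ : Vec (Fin n) n
    σ = tabulate (λ j → punchOut (v≢ j))
    σ-perm : IsPerm n σ
    σ-perm i j eq = punchIn-injective g i j (π-perm _ _ (punchOut-injective (v≢ i) (v≢ j)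
      (trans (sym (lookup∘tabulate _ i)) (trans eq (lookup∘tabulate _ j)))))
    entries : ∀ p → lookup (insert g v σ) p ≡ lookup π p
    entries p with punchInView g p
    ... | at        = lookup-insert g v σ
    ... | punched j = trans (lookup-insert-punchIn g v σ j)
                        (trans (cong (punchIn v) (lookup∘tabulate _ j)) (punchIn-punchOut (v≢ j)))

  insert-surjective-value : ∀ {n} (π : Vec (Fin (suc n)) (suc n)) → IsPerm (suc n) π → ∀ v →
                            ∃₂ λ g σ → IsPerm n σ × insert g v σ ≡ π
  insert-surjective-value π π-perm v with perm-surjective π π-perm v
  ... | g , πg≡v with insert-surjective-at π π-perm g
  ...   | σ , σ-perm , eq = g , σ , σ-perm , subst (λ w → insert g w σ ≡ π) πg≡v eq

  -- Dips, and how inserting a maximum creates them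

  -- The pattern P35 without its unconstrained fifth label.
  record Dip {m} (u : Fin m → ℕ) : Set where
    constructor dip
    field
      i j k l : Fin m
      i<j : toℕ i < toℕ j
      j<k : toℕ j < toℕ k
      k<l : toℕ k < toℕ l
      uj<ui : u j < u i
      uk<ui : u k < u i
      uj<ul : u j < u l
      uk<ul : u k < u l

  -- The last three entries of a dip, from site h on: a maximum inserted at site h completes them.
  record DipTail {m} (u : Fin m → ℕ) (h : ℕ) : Set where
    constructor tail
    field
      j k l : Fin m
      h≤j : h ≤ toℕ j
      j<k : toℕ j < toℕ k
      k<l : toℕ k < toℕ l
      uj<ul : u j < u l
      uk<ul : u k < u l

  -- The first three entries of a dip, before site h: a maximum inserted at site h completes them.
  record DipHead {m} (u : Fin m → ℕ) (h : ℕ) : Set where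
    constructor head
    field
      i j k : Fin m
      i<j : toℕ i < toℕ j
      j<k : toℕ j < toℕ k
      k<h : toℕ k < h
      uj<ui : u j < u i
      uk<ui : u k < u i

  record Insertion {m} (g : Fin (suc m)) (u : Fin m → ℕ) (U : Fin (suc m) → ℕ) : Set where
    field
      order⁺ : ∀ {a b} → u a < u b → U (punchIn g a) < U (punchIn g b)
      order⁻ : ∀ {a b} → U (punchIn g a) < U (punchIn g b) → u a < u b

  module InsertionProperties {m} {g : Fin (suc m)} {u : Fin m → ℕ} {U : Fin (suc m) → ℕ}
                             (I : Insertion g u U) where
    open Insertion I

    dip-insert⁺ : Dip u → Dip U
    dip-insert⁺ (dip i j k l i<j j<k k<l uj<ui uk<ui uj<ul uk<ul) =
      dip (punchIn g i) (punchIn g j) (punchIn g k) (punchIn g l)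
          (punchIn-mono-< g i j i<j) (punchIn-mono-< g j k j<k) (punchIn-mono-< g k l k<l)
          (order⁺ uj<ui) (order⁺ uk<ui) (order⁺ uj<ul) (order⁺ uk<ul)

    dip-before⁻ : (d : Dip U) → toℕ (Dip.l d) < toℕ g → Dip u
    dip-before⁻ (dip i j k l i<j j<k k<l uj<ui uk<ui uj<ul uk<ul) l<g
      with ≢⇒∃punchIn g i (<⇒≢ i<g) | ≢⇒∃punchIn g j (<⇒≢ j<g)
         | ≢⇒∃punchIn g k (<⇒≢ k<g) | ≢⇒∃punchIn g l (<⇒≢ l<g)
      where
      k<g : toℕ k < toℕ g
      k<g = <-trans k<l l<g
      j<g : toℕ j < toℕ g
      j<g = <-trans j<k k<g
      i<g : toℕ i < toℕ g
      i<g = <-trans i<j j<g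
    ... | i′ , refl | j′ , refl | k′ , refl | l′ , refl =
      dip i′ j′ k′ l′ (punchIn-cancel-< g i′ j′ i<j) (punchIn-cancel-< g j′ k′ j<k)
          (punchIn-cancel-< g k′ l′ k<l) (order⁻ uj<ui) (order⁻ uk<ui) (order⁻ uj<ul) (order⁻ uk<ul)

  record InsertMax {m} (g : Fin (suc m)) (u : Fin m → ℕ) (U : Fin (suc m) → ℕ) : Set where
    field
      insertion : Insertion g u U
      below-max : ∀ a → U (punchIn g a) < U g

  module InsertMaxProperties {m} {g : Fin (suc m)} {u : Fin m → ℕ} {U : Fin (suc m) → ℕ}
                             (I : InsertMax g u U) where
    open InsertMax I
    open Insertion insertion
    open InsertionProperties insertion public

    G : ℕ
    G = toℕ g

    below⇒punched : ∀ {p q} → U p < U q → ∃ λ j → punchIn g j ≡ p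
    below⇒punched {p} {q} Up<Uq with punchInView g p | punchInView g q
    ... | at        | at        = ⊥-elim (<-irrefl refl Up<Uq)
    ... | at        | punched j = ⊥-elim (<⇒≱ Up<Uq (<⇒≤ (below-max j)))
    ... | punched j | _         = j , refl

    dip-insert⁻ : Dip U → Dip u ⊎ DipTail u G ⊎ DipHead u G
    dip-insert⁻ (dip i j k l i<j j<k k<l uj<ui uk<ui uj<ul uk<ul)
      with below⇒punched uj<ui | below⇒punched uk<ui
    ... | j′ , refl | k′ , refl with punchInView g i | punchInView g l
    ... | at         | at         = ⊥-elim (<-irrefl refl (<-trans i<j (<-trans j<k k<l)))
    ... | at         | punched l′ =
      inj₂ (inj₁ (tail j′ k′ l′ (<punchIn⇒≤ g j′ i<j) (punchIn-cancel-< g j′ k′ j<k)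
                       (punchIn-cancel-< g k′ l′ k<l) (order⁻ uj<ul) (order⁻ uk<ul)))
    ... | punched i′ | at         =
      inj₂ (inj₂ (head i′ j′ k′ (punchIn-cancel-< g i′ j′ i<j) (punchIn-cancel-< g j′ k′ j<k)
                       (punchIn<⇒< g k′ k<l) (order⁻ uj<ui) (order⁻ uk<ui)))
    ... | punched i′ | punched l′ =
      inj₁ (dip i′ j′ k′ l′ (punchIn-cancel-< g i′ j′ i<j) (punchIn-cancel-< g j′ k′ j<k)
                (punchIn-cancel-< g k′ l′ k<l) (order⁻ uj<ui) (order⁻ uk<ui)
                (order⁻ uj<ul) (order⁻ uk<ul))

    dip-from-tail : DipTail u G → Dip U
    dip-from-tail (tail j k l G≤j j<k k<l uj<ul uk<ul) =
      dip g (punchIn g j) (punchIn g k) (punchIn g l) (≤⇒<punchIn g j G≤j)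
          (punchIn-mono-< g j k j<k) (punchIn-mono-< g k l k<l)
          (below-max j) (below-max k) (order⁺ uj<ul) (order⁺ uk<ul)

    dip-from-head : DipHead u G → Dip U
    dip-from-head (head i j k i<j j<k k<G uj<ui uk<ui) =
      dip (punchIn g i) (punchIn g j) (punchIn g k) g
          (punchIn-mono-< g i j i<j) (punchIn-mono-< g j k j<k)
          (<⇒punchIn< g k k<G)
          (order⁺ uj<ui) (order⁺ uk<ui) (below-max j) (below-max k)

    tail-insert⁺ : ∀ {h} → DipTail u h → DipTail U h
    tail-insert⁺ (tail j k l h≤j j<k k<l uj<ul uk<ul) =
      tail (punchIn g j) (punchIn g k) (punchIn g l) (≤-trans h≤j (punchIn-≥ g j))
           (punchIn-mono-< g j k j<k) (punchIn-mono-< g k l k<l) (order⁺ uj<ul) (order⁺ uk<ul)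

    tail-insert⁻ : ∀ {h} → h ≤ G → DipTail U h → 2 + h ≤ G ⊎ DipTail u h
    tail-insert⁻ h≤G (tail j k l h≤j j<k k<l uj<ul uk<ul)
      with below⇒punched uj<ul | below⇒punched uk<ul
    ... | j′ , refl | k′ , refl with punchInView g l
    ... | at         = inj₁ (≤-trans (s≤s (≤-trans (s≤s h≤j) j<k)) k<l)
    ... | punched l′ =
      inj₂ (tail j′ k′ l′ (≤-punchIn⇒≤ g j′ h≤G h≤j) (punchIn-cancel-< g j′ k′ j<k)
                 (punchIn-cancel-< g k′ l′ k<l) (order⁻ uj<ul) (order⁻ uk<ul))

    tail-insert-shift⁻ : ∀ {h} → G ≤ h → DipTail U (suc h) → DipTail u h
    tail-insert-shift⁻ G≤h (tail j k l h<j j<k k<l uj<ul uk<ul)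
      with ≢⇒∃punchIn g j (>⇒≢ G<j) | ≢⇒∃punchIn g k (>⇒≢ G<k) | ≢⇒∃punchIn g l (>⇒≢ G<l)
      where
      G<j : G < toℕ j
      G<j = <-≤-trans (s≤s G≤h) h<j
      G<k : G < toℕ k
      G<k = <-trans G<j j<k
      G<l : G < toℕ l
      G<l = <-trans G<k k<l
    ... | j′ , refl | k′ , refl | l′ , refl =
      tail j′ k′ l′ (s≤s⁻¹ (≤-trans h<j (punchIn-≤ g j′))) (punchIn-cancel-< g j′ k′ j<k)
           (punchIn-cancel-< g k′ l′ k<l) (order⁻ uj<ul) (order⁻ uk<ul)

    tail-before-max : ∀ {h} → 2 + h ≤ G → DipTail U h
    tail-before-max {h} 2+h≤G =
      tail (punchIn g a) (punchIn g b) g (≤-trans (≤-reflexive (sym a≡h)) (punchIn-≥ g a))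
           (punchIn-mono-< g a b (subst₂ _<_ (sym a≡h) (sym b≡1+h) (n<1+n h))) (<⇒punchIn< g b b<G)
           (below-max a) (below-max b)
      where
      1+h<m : suc h < m
      1+h<m = <-≤-trans 2+h≤G (s≤s⁻¹ (toℕ<n g))
      a b : Fin m
      a = fromℕ< (<-trans (n<1+n h) 1+h<m)
      b = fromℕ< 1+h<m
      a≡h : toℕ a ≡ h
      a≡h = toℕ-fromℕ< _
      b≡1+h : toℕ b ≡ suc h
      b≡1+h = toℕ-fromℕ< _
      b<G : toℕ b < G
      b<G = subst (_< G) (sym b≡1+h) 2+h≤G

    head-insert⁺ : ∀ {h} → DipHead u h → DipHead U (suc h)
    head-insert⁺ (head i j k i<j j<k k<h uj<ui uk<ui) =
      head (punchIn g i) (punchIn g j) (punchIn g k) (punchIn-mono-< g i j i<j) (punchIn-mono-< g j k j<k)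
           (≤-<-trans (punchIn-≤ g k) (s≤s k<h)) (order⁺ uj<ui) (order⁺ uk<ui)

    head-insert⁻ : ∀ {h} → h ≤ G → DipHead U h → DipHead u h
    head-insert⁻ h≤G (head i j k i<j j<k k<h uj<ui uk<ui)
      with ≢⇒∃punchIn g i (<⇒≢ i<G) | ≢⇒∃punchIn g j (<⇒≢ j<G) | ≢⇒∃punchIn g k (<⇒≢ k<G)
      where
      k<G : toℕ k < G
      k<G = <-≤-trans k<h h≤G
      j<G : toℕ j < G
      j<G = <-trans j<k k<G
      i<G : toℕ i < G
      i<G = <-trans i<j j<G
    ... | i′ , refl | j′ , refl | k′ , refl =
      head i′ j′ k′ (punchIn-cancel-< g i′ j′ i<j) (punchIn-cancel-< g j′ k′ j<k)
           (≤-<-trans (punchIn-≥ g k′) k<h) (order⁻ uj<ui) (order⁻ uk<ui)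

    head-insert-shift⁻ : ∀ {h} → G ≤ h → DipHead U (suc h) → 2 + G ≤ h ⊎ DipHead u h
    head-insert-shift⁻ G≤h (head i j k i<j j<k k<h uj<ui uk<ui)
      with below⇒punched uj<ui | below⇒punched uk<ui
    ... | j′ , refl | k′ , refl with punchInView g i
    ... | at         = inj₁ (≤-trans (s≤s i<j) (≤-trans j<k (s≤s⁻¹ k<h)))
    ... | punched i′ = inj₂ (head i′ j′ k′ (punchIn-cancel-< g i′ j′ i<j) (punchIn-cancel-< g j′ k′ j<k)
                                  (punchIn<1+⇒< g k′ G≤h k<h) (order⁻ uj<ui) (order⁻ uk<ui))

    head-after-max : ∀ {h} → 2 + G ≤ h → h ≤ m → DipHead U (suc h)
    head-after-max {h} 2+G≤h h≤m =
      head g (punchIn g a) (punchIn g b) (≤⇒<punchIn g a (≤-reflexive (sym a≡G)))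
           (punchIn-mono-< g a b (subst₂ _<_ (sym a≡G) (sym b≡1+G) (n<1+n G)))
           (≤-trans (s≤s (punchIn-≤ g b)) (s≤s (subst (λ x → suc x ≤ h) (sym b≡1+G) 2+G≤h)))
           (below-max a) (below-max b)
      where
      1+G<m : suc G < m
      1+G<m = <-≤-trans 2+G≤h h≤m
      a b : Fin m
      a = fromℕ< (<-trans (n<1+n G) 1+G<m)
      b = fromℕ< 1+G<m
      a≡G : toℕ a ≡ G
      a≡G = toℕ-fromℕ< _
      b≡1+G : toℕ b ≡ suc G
      b≡1+G = toℕ-fromℕ< _

  -- The interval of active sites

  <⊔⇒ : ∀ {h a b} → h < a ⊔ b → h < a ⊎ h < b
  <⊔⇒ {h} {a} {b} h<a⊔b with ⊔-sel a b
  ... | inj₁ a⊔b≡a = inj₁ (subst (h <_) a⊔b≡a h<a⊔b)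
  ... | inj₂ a⊔b≡b = inj₂ (subst (h <_) a⊔b≡b h<a⊔b)

  ⊓≤⇒ : ∀ {a b c} → a ⊓ b ≤ c → a ≤ c ⊎ b ≤ c
  ⊓≤⇒ {a} {b} {c} a⊓b≤c with ⊓-sel a b
  ... | inj₁ a⊓b≡a = inj₁ (subst (_≤ c) a⊓b≡a a⊓b≤c)
  ... | inj₂ a⊓b≡b = inj₂ (subst (_≤ c) a⊓b≡b a⊓b≤c)

  -- For dip-free u: r, …, l are the sites where a new maximum can go without creating a dip.
  record ActiveInterval {m} (u : Fin m → ℕ) (r l : ℕ) : Set where
    field
      r≤l : r ≤ l
      l≤m : l ≤ m
      tail⇒< : ∀ {h} → DipTail u h → h < r
      <⇒tail : ∀ {h} → h < r → DipTail u h
      head⇒> : ∀ {h} → h ≤ m → DipHead u h → l < h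
      >⇒head : ∀ {h} → h ≤ m → l < h → DipHead u h

  module _ {m} {g : Fin (suc m)} {u : Fin m → ℕ} {U : Fin (suc m) → ℕ} {r l : ℕ}
           (A : ActiveInterval u r l) (I : InsertMax g u U) (r≤G : r ≤ toℕ g) (G≤l : toℕ g ≤ l) where
    open ActiveInterval A
    open InsertMaxProperties I

    G≤m : G ≤ m
    G≤m = s≤s⁻¹ (toℕ<n g)

    avoids-insert : ¬ Dip u → ¬ Dip U
    avoids-insert no-dip d with dip-insert⁻ d
    ... | inj₁ d′         = no-dip d′
    ... | inj₂ (inj₁ tl)  = <⇒≱ (tail⇒< tl) r≤G
    ... | inj₂ (inj₂ hd)  = <⇒≱ (head⇒> G≤m hd) G≤l

    -- The new maximum makes sites up to G − 2 tail sites and sites from G + 3 on head sites.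
    active-insert : ActiveInterval U (pred G ⊔ r) (suc (suc G) ⊓ suc l)
    active-insert = record
      { r≤l    = ≤-trans (⊔-lub pred[n]≤n r≤G)
                         (⊓-glb (≤-trans (n≤1+n G) (n≤1+n (suc G))) (≤-trans G≤l (n≤1+n l)))
      ; l≤m    = ≤-trans (m⊓n≤n _ _) (s≤s l≤m)
      ; tail⇒< = tail⇒<′
      ; <⇒tail = <⇒tail′
      ; head⇒> = head⇒>′
      ; >⇒head = >⇒head′
      }
      where
      tail⇒<′ : ∀ {h} → DipTail U h → h < pred G ⊔ r
      tail⇒<′ {h} tl with h ≤? G
      ... | yes h≤G = [ (λ 2+h≤G → m<n⇒m<n⊔o r (suc[m]≤n⇒m≤pred[n] 2+h≤G))
                      , (λ tl′ → m<n⇒m<o⊔n (pred G) (tail⇒< tl′)) ]′ (tail-insert⁻ h≤G tl)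
      ... | no h≰G with ≰⇒> h≰G
      ...   | s≤s G≤h′ = ⊥-elim (<⇒≱ (tail⇒< (tail-insert-shift⁻ G≤h′ tl)) (≤-trans r≤G G≤h′))

      <⇒tail′ : ∀ {h} → h < pred G ⊔ r → DipTail U h
      <⇒tail′ h<r′ =
        [ (λ h<G-1 → tail-before-max (pred-cancel-< h<G-1)) , (tail-insert⁺ ∘ <⇒tail) ]′ (<⊔⇒ h<r′)

      head⇒>′ : ∀ {h} → h ≤ suc m → DipHead U h → suc (suc G) ⊓ suc l < h
      head⇒>′ {h} h≤1+m hd with h ≤? G
      ... | yes h≤G =
        ⊥-elim (<⇒≱ (head⇒> (≤-trans h≤G G≤m) (head-insert⁻ h≤G hd)) (≤-trans h≤G G≤l))
      ... | no h≰G with ≰⇒> h≰G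
      ...   | s≤s G≤h′ = s≤s ([ (λ 2+G≤h′ → ≤-trans (m⊓n≤m _ _) 2+G≤h′)
                               , (λ hd′ → ≤-trans (m⊓n≤n _ _) (head⇒> (s≤s⁻¹ h≤1+m) hd′)) ]′
                               (head-insert-shift⁻ G≤h′ hd))

      >⇒head′ : ∀ {h} → h ≤ suc m → suc (suc G) ⊓ suc l < h → DipHead U h
      >⇒head′ (s≤s h′≤m) (s≤s l′≤h′) =
        [ (λ 2+G≤h′ → head-after-max 2+G≤h′ h′≤m)
        , (λ l<h′ → head-insert⁺ (>⇒head h′≤m l<h′)) ]′ (⊓≤⇒ l′≤h′)

  val : ∀ {k m} → Vec (Fin k) m → Fin m → ℕ
  val σ = toℕ ∘ lookup σ

  insertion-val : ∀ {n} (g v : Fin (suc n)) (σ : Vec (Fin n) n) → Insertion g (val σ) (val (insert g v σ))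
  insertion-val g v σ = record
    { order⁺ = λ {a} {b} → subst₂ _<_ (sym (entry a)) (sym (entry b)) ∘ punchIn-mono-< v _ _
    ; order⁻ = λ {a} {b} → punchIn-cancel-< v _ _ ∘ subst₂ _<_ (entry a) (entry b)
    }
    where
    entry : ∀ j → val (insert g v σ) (punchIn g j) ≡ toℕ (punchIn v (lookup σ j))
    entry j = cong toℕ (lookup-insert-punchIn g v σ j)

  insert-max : ∀ {m} (g : Fin (suc m)) (σ : Vec (Fin m) m) → InsertMax g (val σ) (val (insert g (fromℕ m) σ))
  insert-max {m} g σ = record
    { insertion = insertion-val g (fromℕ m) σ
    ; below-max = λ a → subst₂ _<_
        (sym (trans (cong toℕ (lookup-insert-punchIn g (fromℕ m) σ a)) (toℕ-punchIn-fromℕ (lookup σ a))))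
        (sym (trans (cong toℕ (lookup-insert g (fromℕ m) σ)) (toℕ-fromℕ m)))
        (toℕ<n (lookup σ a))
    }

  -- The generating tree

  data Width : Set where
    w₀ w₁ w₂ w₃ : Width

  ⌊_⌋ : Width → ℕ
  ⌊ w₀ ⌋ = 0
  ⌊ w₁ ⌋ = 1
  ⌊ w₂ ⌋ = 2
  ⌊ w₃ ⌋ = 3

  succession : (w : Width) → Fin (suc ⌊ w ⌋) → Width
  succession w₀ zero                   = w₁
  succession w₁ zero                   = w₂
  succession w₁ (suc zero)             = w₂
  succession w₂ zero                   = w₂
  succession w₂ (suc zero)             = w₃
  succession w₂ (suc (suc zero))       = w₂
  succession w₃ zero                   = w₂
  succession w₃ (suc zero)             = w₃
  succession w₃ (suc (suc zero))       = w₃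
  succession w₃ (suc (suc (suc zero))) = w₂

  succession-width : ∀ w k → suc (suc (toℕ k)) ⊓ suc ⌊ w ⌋ ≡ ⌊ succession w k ⌋ + pred (toℕ k)
  succession-width w₀ zero                   = refl
  succession-width w₁ zero                   = refl
  succession-width w₁ (suc zero)             = refl
  succession-width w₂ zero                   = refl
  succession-width w₂ (suc zero)             = refl
  succession-width w₂ (suc (suc zero))       = refl
  succession-width w₃ zero                   = refl
  succession-width w₃ (suc zero)             = refl
  succession-width w₃ (suc (suc zero))       = refl
  succession-width w₃ (suc (suc (suc zero))) = refl

  -- n as a site, saturating at m; only used for n ≤ m.
  clamp : ∀ m → ℕ → Fin (suc m)
  clamp zero    _       = zero
  clamp (suc m) zero    = zero
  clamp (suc m) (suc n) = suc (clamp m n)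

  toℕ-clamp : ∀ {m n} → n ≤ m → toℕ (clamp m n) ≡ n
  toℕ-clamp {zero}  z≤n       = refl
  toℕ-clamp {suc m} z≤n       = refl
  toℕ-clamp {suc m} (s≤s n≤m) = cong suc (toℕ-clamp n≤m)

  pred[k+r]⊔r : ∀ k r → pred (k + r) ⊔ r ≡ pred k + r
  pred[k+r]⊔r zero    r = m≤n⇒m⊔n≡n pred[n]≤n
  pred[k+r]⊔r (suc k) r = m≥n⇒m⊔n≡m (m≤n+m r k)

  record Node (m : ℕ) : Set where
    constructor node
    field
      first : ℕ
      width : Width
      perm  : Vec (Fin m) m

    last : ℕ
    last = ⌊ width ⌋ + first

    site : Fin (suc ⌊ width ⌋) → Fin (suc m)
    site k = clamp m (toℕ k + first)

  open Node

  child : ∀ {m} (nd : Node m) → Fin (suc ⌊ width nd ⌋) → Node (suc m)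
  child {m} nd k = node (pred (toℕ k) + first nd) (succession (width nd) k) (insert (site nd k) (fromℕ m) (perm nd))

  children : ∀ {m} → Node m → List (Node (suc m))
  children nd = map (child nd) (allFin _)

  tree : ∀ m → List (Node m)
  tree zero    = node 0 w₀ [] ∷ []
  tree (suc m) = concatMap children (tree m)

  record Valid {m} (nd : Node m) : Set where
    field
      isPerm   : IsPerm m (perm nd)
      dip-free : ¬ Dip (val (perm nd))
      active   : ActiveInterval (val (perm nd)) (first nd) (last nd)

  module _ {m} {nd : Node m} (V : Valid nd) where
    open Valid V

    toℕ-site : ∀ k → toℕ (site nd k) ≡ toℕ k + first nd
    toℕ-site k = toℕ-clamp (≤-trans (+-monoˡ-≤ (first nd) (s≤s⁻¹ (toℕ<n k))) (ActiveInterval.l≤m active))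

    child-valid : ∀ k → Valid (child nd k)
    child-valid k = record
      { isPerm   = insert-perm g (fromℕ m) (perm nd) isPerm
      ; dip-free = avoids-insert active I r≤G G≤l dip-free
      ; active   = subst₂ (ActiveInterval _) first′ last′ (active-insert active I r≤G G≤l)
      }
      where
      g : Fin (suc m)
      g = site nd k
      I : InsertMax g (val (perm nd)) (val (perm (child nd k)))
      I = insert-max g (perm nd)
      r≤G : first nd ≤ toℕ g
      r≤G = subst (first nd ≤_) (sym (toℕ-site k)) (m≤n+m (first nd) (toℕ k))
      G≤l : toℕ g ≤ last nd
      G≤l = subst (_≤ last nd) (sym (toℕ-site k)) (+-monoˡ-≤ (first nd) (s≤s⁻¹ (toℕ<n k)))
      first′ : pred (toℕ g) ⊔ first nd ≡ first (child nd k)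
      first′ = trans (cong (λ G → pred G ⊔ first nd) (toℕ-site k)) (pred[k+r]⊔r (toℕ k) (first nd))
      last′ : suc (suc (toℕ g)) ⊓ suc (last nd) ≡ last (child nd k)
      last′ = begin
        suc (suc (toℕ g)) ⊓ suc (last nd)
          ≡⟨ cong (λ G → suc (suc G) ⊓ suc (last nd)) (toℕ-site k) ⟩
        (suc (suc (toℕ k)) + first nd) ⊓ (suc ⌊ width nd ⌋ + first nd)
          ≡⟨ sym (+-distribʳ-⊓ (first nd) (suc (suc (toℕ k))) (suc ⌊ width nd ⌋)) ⟩
        (suc (suc (toℕ k)) ⊓ suc ⌊ width nd ⌋) + first nd
          ≡⟨ cong (_+ first nd) (succession-width (width nd) k) ⟩
        (⌊ succession (width nd) k ⌋ + pred (toℕ k)) + first nd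
          ≡⟨ +-assoc ⌊ succession (width nd) k ⌋ (pred (toℕ k)) (first nd) ⟩
        last (child nd k) ∎
        where open ≡-Reasoning

  root-valid : Valid (node 0 w₀ [])
  root-valid = record
    { isPerm   = λ ()
    ; dip-free = λ { (dip () _ _ _ _ _ _ _ _ _ _) }
    ; active   = record
      { r≤l    = z≤n
      ; l≤m    = z≤n
      ; tail⇒< = λ { (tail () _ _ _ _ _ _ _) }
      ; <⇒tail = λ ()
      ; head⇒> = λ { _ (head () _ _ _ _ _ _ _) }
      ; >⇒head = λ { z≤n () }
      }
    }

  tree-valid : ∀ m → All Valid (tree m)
  tree-valid zero    = root-valid ∷ []
  tree-valid (suc m) =
    All.concat⁺ (All.map⁺ (All.map (λ V → All.map⁺ (All.universal (child-valid V) _)) (tree-valid m)))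

  ∈-children-perms : ∀ {m} {nd : Node m} {π} → π ∈ map perm (children nd) →
                     ∃ λ g → π ≡ insert g (fromℕ m) (perm nd)
  ∈-children-perms {nd = nd} π∈ with ∈-map⁻ perm π∈
  ... | c , c∈ , refl with ∈-map⁻ (child nd) c∈
  ...   | k , _ , refl = site nd k , refl

  children-unique : ∀ {m} {nd : Node m} → Valid nd → Unique (map perm (children nd))
  children-unique {nd = nd} V = subst Unique (map-∘ (allFin _)) (Unique.map⁺ site-injective (Unique.allFin⁺ _))
    where
    site-injective : ∀ {k k′} → perm (child nd k) ≡ perm (child nd k′) → k ≡ k′
    site-injective {k} {k′} eq = toℕ-injective (+-cancelʳ-≡ (first nd) _ _
      (trans (sym (toℕ-site V k)) (trans (cong toℕ (insert-injectiveˡ eq)) (toℕ-site V k′))))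

  children-disjoint : ∀ {m} {x y : Node m} → perm x ≢ perm y →
                      Disjoint (map perm (children x)) (map perm (children y))
  children-disjoint x≢y (π∈x , π∈y) with ∈-children-perms π∈x | ∈-children-perms π∈y
  ... | _ , refl | _ , eq = x≢y (insert-injectiveʳ eq)

  tree-unique : ∀ m → Unique (map perm (tree m))
  tree-unique zero    = [] ∷ []
  tree-unique (suc m) = subst Unique (sym (map-concatMap perm children (tree m)))
    (Unique.concat⁺ (All.map⁺ (All.map children-unique (tree-valid m)))
                    (AllPairs.map⁺ (AllPairs.map children-disjoint (AllPairs.map⁻ (tree-unique m)))))

  module _ {m} {nd : Node m} (V : Valid nd) (g : Fin (suc m))
           (dip-free′ : ¬ Dip (val (insert g (fromℕ m) (perm nd)))) where
    open Valid V
    open ActiveInterval active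
    open InsertMaxProperties (insert-max g (perm nd))

    first≤site : first nd ≤ toℕ g
    first≤site = ≮⇒≥ (dip-free′ ∘ dip-from-tail ∘ <⇒tail)

    site≤last : toℕ g ≤ last nd
    site≤last = ≮⇒≥ (dip-free′ ∘ dip-from-head ∘ >⇒head (s≤s⁻¹ (toℕ<n g)))

    site-surjective : ∃ λ k → site nd k ≡ g
    site-surjective =
      k , toℕ-injective (trans (toℕ-site V k) (trans (cong (_+ first nd) (toℕ-fromℕ< _)) (m∸n+n≡m first≤site)))
      where
      offset≤width : toℕ g ∸ first nd ≤ ⌊ width nd ⌋
      offset≤width =
        subst (toℕ g ∸ first nd ≤_) (m+n∸n≡m ⌊ width nd ⌋ (first nd)) (∸-monoˡ-≤ (first nd) site≤last)
      k : Fin (suc ⌊ width nd ⌋)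
      k = fromℕ< (s≤s offset≤width)

  tree-complete : ∀ m {σ : Vec (Fin m) m} → IsPerm m σ → ¬ Dip (val σ) → σ ∈ map perm (tree m)
  tree-complete zero    {[]} _ _ = here refl
  tree-complete (suc m) {σ} σ-perm σ-free with insert-surjective-value σ σ-perm (fromℕ m)
  ... | g , τ , τ-perm , refl
    with ∈-map⁻ perm (tree-complete m τ-perm (σ-free ∘ InsertionProperties.dip-insert⁺ (insertion-val g _ τ)))
  ...   | nd , nd∈ , refl with site-surjective (All.lookup (tree-valid m) nd∈) g σ-free
  ...     | k , refl = ∈-map⁺ perm (∈-concat⁺′ (∈-map⁺ (child nd) (∈-allFin k)) (∈-map⁺ children nd∈))

  -- Counting the tree by widths

  record Census : Set where
    constructor ⟨_,_,_,_⟩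
    field
      c₀ c₁ c₂ c₃ : ℕ

  ⟨⟩-cong : ∀ {a b c d a′ b′ c′ d′} → a ≡ a′ → b ≡ b′ → c ≡ c′ → d ≡ d′ →
            ⟨ a , b , c , d ⟩ ≡ ⟨ a′ , b′ , c′ , d′ ⟩
  ⟨⟩-cong refl refl refl refl = refl

  empty : Census
  empty = ⟨ 0 , 0 , 0 , 0 ⟩

  _⊕_ : Census → Census → Census
  ⟨ a , b , c , d ⟩ ⊕ ⟨ a′ , b′ , c′ , d′ ⟩ = ⟨ a + a′ , b + b′ , c + c′ , d + d′ ⟩

  ⊕-assoc : ∀ x y z → (x ⊕ y) ⊕ z ≡ x ⊕ (y ⊕ z)
  ⊕-assoc ⟨ a , b , c , d ⟩ ⟨ a′ , b′ , c′ , d′ ⟩ ⟨ a″ , b″ , c″ , d″ ⟩ =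
    ⟨⟩-cong (+-assoc a a′ a″) (+-assoc b b′ b″) (+-assoc c c′ c″) (+-assoc d d′ d″)

  unit : Width → Census
  unit w₀ = ⟨ 1 , 0 , 0 , 0 ⟩
  unit w₁ = ⟨ 0 , 1 , 0 , 0 ⟩
  unit w₂ = ⟨ 0 , 0 , 1 , 0 ⟩
  unit w₃ = ⟨ 0 , 0 , 0 , 1 ⟩

  total : Census → ℕ
  total ⟨ a , b , c , d ⟩ = a + b + c + d

  total-⊕ : ∀ x y → total (x ⊕ y) ≡ total x + total y
  total-⊕ ⟨ a , b , c , d ⟩ ⟨ a′ , b′ , c′ , d′ ⟩ = lemma a b c d a′ b′ c′ d′
    where
    lemma : ∀ a b c d a′ b′ c′ d′ →
            a + a′ + (b + b′) + (c + c′) + (d + d′) ≡ a + b + c + d + (a′ + b′ + c′ + d′)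
    lemma = solve-∀

  total-unit : ∀ w → total (unit w) ≡ 1
  total-unit w₀ = refl
  total-unit w₁ = refl
  total-unit w₂ = refl
  total-unit w₃ = refl

  step : Census → Census
  step ⟨ a , b , c , d ⟩ = ⟨ 0 , a , 2 * (b + c + d) , c + 2 * d ⟩

  step-⊕ : ∀ x y → step (x ⊕ y) ≡ step x ⊕ step y
  step-⊕ ⟨ a , b , c , d ⟩ ⟨ a′ , b′ , c′ , d′ ⟩ =
    ⟨⟩-cong refl refl (lemma₂ b c d b′ c′ d′) (lemma₃ c d c′ d′)
    where
    lemma₂ : ∀ b c d b′ c′ d′ →
             2 * (b + b′ + (c + c′) + (d + d′)) ≡ 2 * (b + c + d) + 2 * (b′ + c′ + d′)
    lemma₂ = solve-∀
    lemma₃ : ∀ c d c′ d′ → c + c′ + 2 * (d + d′) ≡ c + 2 * d + (c′ + 2 * d′)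
    lemma₃ = solve-∀

  census : ∀ {m} → List (Node m) → Census
  census []         = empty
  census (nd ∷ nds) = unit (width nd) ⊕ census nds

  census-++ : ∀ {m} (xs ys : List (Node m)) → census (xs ++ ys) ≡ census xs ⊕ census ys
  census-++ []       ys = refl
  census-++ (x ∷ xs) ys = trans (cong (unit (width x) ⊕_) (census-++ xs ys)) (sym (⊕-assoc (unit (width x)) _ _))

  census-children : ∀ {m} (nd : Node m) → census (children nd) ≡ step (unit (width nd))
  census-children (node _ w₀ _) = refl
  census-children (node _ w₁ _) = refl
  census-children (node _ w₂ _) = refl
  census-children (node _ w₃ _) = refl

  census-concatMap : ∀ {m} (nds : List (Node m)) → census (concatMap children nds) ≡ step (census nds)
  census-concatMap []         = refl
  census-concatMap (nd ∷ nds) = begin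
    census (children nd ++ concatMap children nds)
      ≡⟨ census-++ (children nd) _ ⟩
    census (children nd) ⊕ census (concatMap children nds)
      ≡⟨ cong₂ _⊕_ (census-children nd) (census-concatMap nds) ⟩
    step (unit (width nd)) ⊕ step (census nds)
      ≡⟨ sym (step-⊕ (unit (width nd)) (census nds)) ⟩
    step (census (nd ∷ nds))
      ∎
    where open ≡-Reasoning

  length≡total∘census : ∀ {m} (nds : List (Node m)) → length nds ≡ total (census nds)
  length≡total∘census []         = refl
  length≡total∘census (nd ∷ nds) = sym (begin
    total (unit (width nd) ⊕ census nds)
      ≡⟨ total-⊕ (unit (width nd)) (census nds) ⟩
    total (unit (width nd)) + total (census nds)
      ≡⟨ cong₂ _+_ (total-unit (width nd)) (sym (length≡total∘census nds)) ⟩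
    suc (length nds)
      ∎)
    where open ≡-Reasoning

  levelCensus : ℕ → Census
  levelCensus zero    = unit w₀
  levelCensus (suc m) = step (levelCensus m)

  census-tree : ∀ m → census (tree m) ≡ levelCensus m
  census-tree zero    = refl
  census-tree (suc m) = trans (census-concatMap (tree m)) (cong step (census-tree m))

  dipFreeCount : ℕ → ℕ
  dipFreeCount m = total (levelCensus m)

  length-tree : ∀ m → length (map perm (tree m)) ≡ dipFreeCount m
  length-tree m = trans (length-map perm (tree m)) (trans (length≡total∘census (tree m)) (cong total (census-tree m)))

  total-step² : ∀ c → total (step (step c)) + 2 * total c ≡ 4 * total (step c)
  total-step² ⟨ a , b , c , d ⟩ = lemma a b c d
    where
    lemma : ∀ a b c d →
            0 + 0 + 2 * (a + 2 * (b + c + d) + (c + 2 * d)) + (2 * (b + c + d) + 2 * (c + 2 * d))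
              + 2 * (a + b + c + d)
            ≡ 4 * (0 + a + 2 * (b + c + d) + (c + 2 * d))
    lemma = solve-∀

  dipFreeCount-rec : ∀ m → dipFreeCount (2 + m) + 2 * dipFreeCount m ≡ 4 * dipFreeCount (1 + m)
  dipFreeCount-rec m = total-step² (levelCensus m)

  -- P35 is a dip followed by one more entry

  increasing : ∀ {k n} (f : Fin (suc k) → Fin n) → (∀ x → toℕ (f (inject₁ x)) < toℕ (f (suc x))) →
               ∀ a b → toℕ a < toℕ b → toℕ (f a) < toℕ (f b)
  increasing         f step zero    (suc zero)    _         = step zero
  increasing {suc k} f step zero    (suc (suc b)) _         =
    <-trans (step zero) (increasing (f ∘ suc) (step ∘ suc) zero (suc b) (s≤s z≤n))
  increasing {suc k} f step (suc a) (suc b)       (s≤s a<b) = increasing (f ∘ suc) (step ∘ suc) a b a<b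

  dip⇒occurrence : ∀ {n} (π : Vec (Fin (suc n)) (suc n)) (d : Dip (val π)) →
                   toℕ (Dip.l d) < n → Occurrence P35 π
  dip⇒occurrence {n} π (dip i j k l i<j j<k k<l uj<ui uk<ui uj<ul uk<ul) l<n = pos , increasing pos consecutive , related
    where
    pos : Fin 5 → Fin (suc n)
    pos zero                         = i
    pos (suc zero)                   = j
    pos (suc (suc zero))             = k
    pos (suc (suc (suc zero)))       = l
    pos (suc (suc (suc (suc zero)))) = fromℕ n
    consecutive : ∀ x → toℕ (pos (inject₁ x)) < toℕ (pos (suc x))
    consecutive zero                   = i<j
    consecutive (suc zero)             = j<k
    consecutive (suc (suc zero))       = k<l
    consecutive (suc (suc (suc zero))) = subst (toℕ l <_) (sym (toℕ-fromℕ n)) l<n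
    related : ∀ x y → P35 x y → toℕ (lookup π (pos x)) < toℕ (lookup π (pos y))
    related _ _ 2<1 = uj<ui
    related _ _ 3<1 = uk<ui
    related _ _ 2<4 = uj<ul
    related _ _ 3<4 = uk<ul

  occurrence⇒dip : ∀ {n} (π : Vec (Fin (suc n)) (suc n)) → Occurrence P35 π →
                   Σ (Dip (val π)) λ d → toℕ (Dip.l d) < n
  occurrence⇒dip π (pos , mono , related) =
    dip (pos p₀) (pos p₁) (pos p₂) (pos p₃)
        (mono p₀ p₁ (n<1+n 0)) (mono p₁ p₂ (n<1+n 1)) (mono p₂ p₃ (n<1+n 2))
        (related _ _ 2<1) (related _ _ 3<1) (related _ _ 2<4) (related _ _ 3<4) ,
    <-≤-trans (mono p₃ p₄ (n<1+n 3)) (s≤s⁻¹ (toℕ<n (pos p₄)))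
    where
    p₀ p₁ p₂ p₃ p₄ : Fin 5
    p₀ = zero
    p₁ = suc zero
    p₂ = suc (suc zero)
    p₃ = suc (suc (suc zero))
    p₄ = suc (suc (suc (suc zero)))

  module _ {n} (v : Fin (suc n)) (σ : Vec (Fin n) n) where
    open InsertionProperties (insertion-val (fromℕ n) v σ)

    avoids⇒dip-free : Avoids P35 (insert (fromℕ n) v σ) → ¬ Dip (val σ)
    avoids⇒dip-free avoids d = avoids (dip⇒occurrence (insert (fromℕ n) v σ) (dip-insert⁺ d)
      (subst (_< n) (sym (toℕ-punchIn-fromℕ (Dip.l d))) (toℕ<n (Dip.l d))))

    dip-free⇒avoids : ¬ Dip (val σ) → Avoids P35 (insert (fromℕ n) v σ)
    dip-free⇒avoids dip-free occ with occurrence⇒dip (insert (fromℕ n) v σ) occ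
    ... | d , l<n = dip-free (dip-before⁻ d (subst (toℕ (Dip.l d) <_) (sym (toℕ-fromℕ n)) l<n))

  length-cartesianProductWith : ∀ {A B C : Set} (f : A → B → C) (xs : List A) (ys : List B) →
                                length (cartesianProductWith f xs ys) ≡ length xs * length ys
  length-cartesianProductWith f []       ys = refl
  length-cartesianProductWith f (x ∷ xs) ys =
    trans (length-++ (map (f x) ys)) (cong₂ _+_ (length-map (f x) ys) (length-cartesianProductWith f xs ys))

  avoiderCount : ℕ → ℕ
  avoiderCount zero    = 1
  avoiderCount (suc n) = suc n * dipFreeCount n

  avoiders-0 : NumAvoiders P35 0 (avoiderCount 0)
  avoiders-0 =
    ([] ∷ []) , (All.[] ∷ []) , (λ { [] → mk⇔ (λ _ → (λ ()) , no-occurrence) (λ _ → here refl) }) , refl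
    where
    no-occurrence : ¬ Occurrence P35 []
    no-occurrence (pos , _) = ¬Fin0 (pos zero)

  avoiders-suc : ∀ n → NumAvoiders P35 (suc n) (avoiderCount (suc n))
  avoiders-suc n = L , unique , (λ π → mk⇔ member⇒ member⇐) , size
    where
    L : List (Vec (Fin (suc n)) (suc n))
    L = cartesianProductWith (insert (fromℕ n)) (allFin (suc n)) (map perm (tree n))

    unique : Unique L
    unique = Unique.cartesianProductWith⁺ (insert (fromℕ n)) insert-injective (Unique.allFin⁺ _) (tree-unique n)

    member⇒ : ∀ {π} → π ∈ L → IsPerm (suc n) π × Avoids P35 π
    member⇒ π∈ with ∈-cartesianProductWith⁻ (insert (fromℕ n)) (allFin _) _ π∈
    ... | v , σ , _ , σ∈ , refl with ∈-map⁻ perm σ∈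
    ...   | nd , nd∈ , refl = insert-perm (fromℕ n) v σ isPerm , dip-free⇒avoids v σ dip-free
      where open Valid (All.lookup (tree-valid n) nd∈)

    member⇐ : ∀ {π} → IsPerm (suc n) π × Avoids P35 π → π ∈ L
    member⇐ {π} (π-perm , avoids) with insert-surjective-at π π-perm (fromℕ n)
    ... | σ , σ-perm , σ↑≡π = subst (_∈ L) σ↑≡π
      (∈-cartesianProductWith⁺ (insert (fromℕ n)) (∈-allFin _)
        (tree-complete n σ-perm (avoids⇒dip-free _ σ (subst (Avoids P35) (sym σ↑≡π) avoids))))

    size : length L ≡ avoiderCount (suc n)
    size = trans (length-cartesianProductWith (insert (fromℕ n)) (allFin (suc n)) (map perm (tree n)))
                 (cong₂ _*_ (length-tabulate {n = suc n} (λ x → x)) (length-tree n))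

module GeneratingFunction where
  open import Data.Nat as ℕ using (ℕ; zero; suc)
  open import Data.Integer using (ℤ; +_; -[1+_]; _+_; _*_; _-_)
  open import Data.Integer.Properties using (pos-+; pos-*)
  open import Data.Integer.Tactic.RingSolver using (solve-∀; solve)
  open import Data.List using ([]; _∷_)
  open import Function using (_∘_)
  open import Relation.Binary.PropositionalEquality using (refl; sym; trans; cong; module ≡-Reasoning)
  open Enumeration using (avoiderCount; dipFreeCount; dipFreeCount-rec)

  cauchy-vanishing : ∀ (f g : Series) n → (∀ i → f i ≡ + 0) → cauchy f g n ≡ + 0
  cauchy-vanishing f g zero    f≡0 rewrite f≡0 0 = refl
  cauchy-vanishing f g (suc n) f≡0 rewrite f≡0 0 | cauchy-vanishing (λ i → f (suc i)) g n (f≡0 ∘ suc) = refl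

  quartic-window : ∀ (f s : Series) n → (∀ i → f (5 ℕ.+ i) ≡ + 0) →
    (f ⊛ s) (5 ℕ.+ n) ≡
      f 0 * s (5 ℕ.+ n) + (f 1 * s (4 ℕ.+ n) + (f 2 * s (3 ℕ.+ n) + (f 3 * s (2 ℕ.+ n) + (f 4 * s (1 ℕ.+ n) + + 0))))
  quartic-window f s n f≡0 =
    cong (λ t → f 0 * s (5 ℕ.+ n) + (f 1 * s (4 ℕ.+ n) + (f 2 * s (3 ℕ.+ n) + (f 3 * s (2 ℕ.+ n)
                  + (f 4 * s (1 ℕ.+ n) + t)))))
         (cauchy-vanishing (λ i → f (5 ℕ.+ i)) s n f≡0)

  den35²-vanishing : ∀ i → (den35 ⊛ den35) (5 ℕ.+ i) ≡ + 0
  den35²-vanishing i = cong (λ t → + 1 * + 0 + (-[1+ 3 ] * + 0 + (+ 2 * + 0 + t)))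
                            (cauchy-vanishing (λ j → den35 (3 ℕ.+ j)) den35 (2 ℕ.+ i) (λ _ → refl))

  annihilator : ∀ (N X Y Z W U A₁ A₂ A₃ A₄ A₅ : ℤ) →
    Z ≡ + 4 * Y - + 2 * X → W ≡ + 4 * Z - + 2 * Y → U ≡ + 4 * W - + 2 * Z →
    A₁ ≡ (+ 1 + N) * X → A₂ ≡ (+ 2 + N) * Y → A₃ ≡ (+ 3 + N) * Z →
    A₄ ≡ (+ 4 + N) * W → A₅ ≡ (+ 5 + N) * U →
    + 1 * A₅ + (-[1+ 7 ] * A₄ + (+ 20 * A₃ + (-[1+ 15 ] * A₂ + (+ 4 * A₁ + + 0)))) ≡ + 0
  annihilator N X Y _ _ _ _ _ _ _ _ refl refl refl refl refl refl refl refl = solve (N ∷ X ∷ Y ∷ [])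

  x+2y≡4z⇒x≡4z-2y : ∀ x y z → x ℕ.+ 2 ℕ.* y ≡ 4 ℕ.* z → + x ≡ + 4 * + z - + 2 * + y
  x+2y≡4z⇒x≡4z-2y x y z eq = begin
    + x                               ≡⟨ add-sub (+ x) (+ 2 * + y) ⟩
    + x + + 2 * + y - + 2 * + y       ≡⟨ cong (λ t → + x + t - + 2 * + y) (sym (pos-* 2 y)) ⟩
    + x + + (2 ℕ.* y) - + 2 * + y     ≡⟨ cong (_- + 2 * + y) (sym (pos-+ x (2 ℕ.* y))) ⟩
    + (x ℕ.+ 2 ℕ.* y) - + 2 * + y     ≡⟨ cong (λ t → + t - + 2 * + y) eq ⟩
    + (4 ℕ.* z) - + 2 * + y           ≡⟨ cong (_- + 2 * + y) (pos-* 4 z) ⟩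
    + 4 * + z - + 2 * + y             ∎
    where
    open ≡-Reasoning
    add-sub : ∀ a b → a ≡ a + b - b
    add-sub = solve-∀

  dipFreeCount-recℤ : ∀ m → + dipFreeCount (2 ℕ.+ m) ≡ + 4 * + dipFreeCount (1 ℕ.+ m) - + 2 * + dipFreeCount m
  dipFreeCount-recℤ m =
    x+2y≡4z⇒x≡4z-2y (dipFreeCount (2 ℕ.+ m)) (dipFreeCount m) (dipFreeCount (1 ℕ.+ m)) (dipFreeCount-rec m)

  avoiderCount-ℤ : ∀ k n → + avoiderCount (suc k ℕ.+ n) ≡ (+ suc k + + n) * + dipFreeCount (k ℕ.+ n)
  avoiderCount-ℤ k n =
    trans (pos-* (suc k ℕ.+ n) (dipFreeCount (k ℕ.+ n))) (cong (_* + dipFreeCount (k ℕ.+ n)) (pos-+ (suc k) n))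

  generating-function : ∀ n → ((den35 ⊛ den35) ⊛ toSeries avoiderCount) n ≡ num35 n
  generating-function 0 = refl
  generating-function 1 = refl
  generating-function 2 = refl
  generating-function 3 = refl
  generating-function 4 = refl
  generating-function (suc (suc (suc (suc (suc n))))) =
    trans (quartic-window (den35 ⊛ den35) (toSeries avoiderCount) n den35²-vanishing) annihilated
    where
    β : ℕ → ℤ
    β k = + dipFreeCount (k ℕ.+ n)
    α : ℕ → ℤ
    α k = + avoiderCount (k ℕ.+ n)
    annihilated : + 1 * α 5 + (-[1+ 7 ] * α 4 + (+ 20 * α 3 + (-[1+ 15 ] * α 2 + (+ 4 * α 1 + + 0)))) ≡ + 0
    annihilated = annihilator (+ n) (β 0) (β 1) (β 2) (β 3) (β 4) (α 1) (α 2) (α 3) (α 4) (α 5)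
      (dipFreeCount-recℤ n) (dipFreeCount-recℤ (1 ℕ.+ n)) (dipFreeCount-recℤ (2 ℕ.+ n))
      (avoiderCount-ℤ 0 n) (avoiderCount-ℤ 1 n) (avoiderCount-ℤ 2 n) (avoiderCount-ℤ 3 n) (avoiderCount-ℤ 4 n)


open Enumeration using (avoiderCount; avoiders-0; avoiders-suc)
open GeneratingFunction using (generating-function)

theorem35 : Σ (ℕ → ℕ) λ a →
    ((n : ℕ) → NumAvoiders P35 n (a n)) ×
    ((n : ℕ) → ((den35 ⊛ den35) ⊛ toSeries a) n ≡ num35 n)
theorem35 = avoiderCount , avoiders , generating-function
  where
  avoiders : ∀ n → NumAvoiders P35 n (avoiderCount n)
  avoiders zero    = avoiders-0
  avoiders (suc n) = avoiders-suc n
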